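{- Let $B$ be a nontrivial Boolean algebra, $M(B)$ the join semilattice of modal operators on $B$ (pointwise join), with top element the unary discriminator $f^{\mathbf 1}$, and let $f\in M(B)$. If $f$ has a dual pseudocomplement $f^\bot$ in $M(B)$, then for every $x\in B\setminus\{0\}$ the supremum $\sum\{ -f(y): 0< y\le x\}$ exists in $B$ and $f^\bot(x)=\sum\{ -f(y):0< y\le x\}$. Conversely, if for every $x\in B\setminus\{0\}$ the supremum $\sum\{ -f(y): 0< y\le x\}$ exists in $B$, then $f$ has a dual pseudocomplement $f^\bot$, given by $f^\bot(0)=0$ and $f^\bot(x)=\sum\{ -f(y):0< y\le x\}$ for $x\neq 0$.
   Context: A modal operator on $B$ is a map $f:B\to B$ with $f(0)=0$ and $f(x+y)=f(x)+f(y)$. $M(B)$ is the set of modal operators, ordered pointwise, with join $(f\lor g)(x)=f(x)+g(x)$. The unary discriminator $f^{\mathbf 1}$ is given by $f^{\mathbf 1}(0)=0$, $f^{\mathbf 1}(x)=1$ for $x\ne0$. A dual pseudocomplement of $f$ is the smallest $g\in M(B)$ (if it exists) with $f\lor g=f^{\mathbf 1}$. -}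

module Defs where

open import Level using (Level; _⊔_)
open import Data.Product using (Σ; ∃; _×_; _,_)
open import Relation.Nullary using (¬_)
open import Algebra.Lattice.Bundles using (BooleanAlgebra)

module BA {c ℓ : Level} (B : BooleanAlgebra c ℓ) where
  open BooleanAlgebra B renaming (¬_ to -_)

  _≤_ : Carrier → Carrier → Set ℓ
  x ≤ y = (x ∨ y) ≈ y

  Nontrivial : Set ℓ
  Nontrivial = ¬ (⊤ ≈ ⊥)

  IsModal : (Carrier → Carrier) → Set (c ⊔ ℓ)
  IsModal f = (∀ {x y} → x ≈ y → f x ≈ f y)
            × (f ⊥ ≈ ⊥)
            × (∀ x y → f (x ∨ y) ≈ (f x ∨ f y))

  IsDiscAt : Carrier → Carrier → Set ℓ
  IsDiscAt x v = (x ≈ ⊥ → v ≈ ⊥) × (¬ (x ≈ ⊥) → v ≈ ⊤)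

  JoinIsDisc : (Carrier → Carrier) → (Carrier → Carrier) → Set (c ⊔ ℓ)
  JoinIsDisc f g = ∀ x → IsDiscAt x (f x ∨ g x)

  _≤M_ : (Carrier → Carrier) → (Carrier → Carrier) → Set (c ⊔ ℓ)
  g ≤M h = ∀ x → g x ≤ h x

  IsDualPseudocomplement : (Carrier → Carrier) → (Carrier → Carrier) → Set (c ⊔ ℓ)
  IsDualPseudocomplement f g =
    IsModal g × JoinIsDisc f g
    × (∀ h → IsModal h → JoinIsDisc f h → g ≤M h)

  IsSup : ∀ {p} → (Carrier → Set p) → Carrier → Set (c ⊔ ℓ ⊔ p)
  IsSup P s = (∀ z → P z → z ≤ s)
            × (∀ u → (∀ z → P z → z ≤ u) → s ≤ u)

  NegImages : (Carrier → Carrier) → Carrier → Carrier → Set (c ⊔ ℓ)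
  NegImages f x z = ∃ λ y → (¬ (y ≈ ⊥)) × (y ≤ x) × (z ≈ (- f y))

-- For 0 < y ≤ x, the dual pseudocomplement g satisfies f y ∨ g y = 1, hence -f(y) ≤ g y ≤ g x, so g x
-- bounds {-f(y) : 0 < y ≤ x}. It is the least bound: for any bound u, the operator
-- z ↦ g(z ∧ -x) ∨ (g(z ∧ x) ∧ u) is again modal with f ∨ (·) = f¹, and at x it is below u.
-- Conversely, the pointwise suprema form a modal operator: an additive one because every nonzero
-- w ≤ a ∨ b meets a or b, and -f(w) ≤ -f(w ∧ a) by monotonicity of f.
module Submission where

open import Defs
open import Level using (Level; _⊔_; Lift; lift; lower)
open import Data.Product using (Σ; _×_; _,_; proj₁; proj₂)
open import Data.Sum using (_⊎_; inj₁; inj₂)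
open import Data.Empty using (⊥-elim)
open import Relation.Nullary using (¬_; Dec; yes; no)
open import Relation.Nullary.Decidable using (map′)
open import Relation.Binary.Structures using (IsPartialOrder)
open import Relation.Binary.Lattice using (IsLattice; Lattice)
open import Algebra.Bundles using (CommutativeMonoid; CommutativeSemiring)
open import Algebra.Lattice.Bundles using (BooleanAlgebra)
open import Axiom.ExcludedMiddle using (ExcludedMiddle)

module BooleanOrder {c ℓ : Level} (B : BooleanAlgebra c ℓ) where
  open BooleanAlgebra B renaming (¬_ to -_)
  open BA B
  open import Algebra.Lattice.Properties.BooleanAlgebra B
    using (∨-idem; ∨-identityˡ; ∨-zeroʳ; ∧-identityʳ; deMorgan₁; ∨-∧-commutativeSemiring)

  ≤-isPartialOrder : IsPartialOrder _≈_ _≤_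
  ≤-isPartialOrder = record
    { isPreorder = record
      { isEquivalence = isEquivalence
      ; reflexive     = λ {x} x≈y → trans (∨-congˡ (sym x≈y)) (trans (∨-idem x) x≈y)
      ; trans         = λ {x} {y} {z} x≤y y≤z →
          trans (∨-congˡ (sym y≤z)) (trans (sym (∨-assoc x y z)) (trans (∨-congʳ x≤y) y≤z))
      }
    ; antisym = λ {x} {y} x≤y y≤x → trans (sym y≤x) (trans (∨-comm y x) x≤y)
    }

  ≤-isLattice : IsLattice _≈_ _≤_ _∨_ _∧_
  ≤-isLattice = record
    { isPartialOrder = ≤-isPartialOrder
    ; supremum = λ x y →
        trans (sym (∨-assoc x x y)) (∨-congʳ (∨-idem x)) ,
        trans (sym (∨-assoc y x y))
          (trans (∨-congʳ (∨-comm y x)) (trans (∨-assoc x y y) (∨-congˡ (∨-idem y)))) ,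
        λ z x≤z y≤z → trans (∨-assoc x y z) (trans (∨-congˡ y≤z) x≤z)
    ; infimum = λ x y →
        trans (∨-comm (x ∧ y) x) (∨-absorbs-∧ x y) ,
        trans (∨-congʳ (∧-comm x y)) (trans (∨-comm (y ∧ x) y) (∨-absorbs-∧ y x)) ,
        λ z z≤x z≤y → trans (∨-distribˡ-∧ z x y) (∧-cong z≤x z≤y)
    }

  ≤-lattice : Lattice c ℓ ℓ
  ≤-lattice = record { isLattice = ≤-isLattice }

  open Lattice ≤-lattice public
    using (poset; x≤x∨y; y≤x∨y; ∨-least; x∧y≤x; x∧y≤y; ∧-greatest)
    renaming (refl to ≤-refl; reflexive to ≤-reflexive; trans to ≤-trans; antisym to ≤-antisym)
  open import Relation.Binary.Lattice.Properties.JoinSemilattice (Lattice.joinSemilattice ≤-lattice)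
    public using (∨-monotonic)
  open import Algebra.Properties.CommutativeSemigroup
    (CommutativeMonoid.commutativeSemigroup
      (CommutativeSemiring.+-commutativeMonoid ∨-∧-commutativeSemiring))
    public using (interchange)

  ⊥-minimum : ∀ x → ⊥ ≤ x
  ⊥-minimum = ∨-identityˡ

  ⊤-maximum : ∀ x → x ≤ ⊤
  ⊤-maximum = ∨-zeroʳ

  ⊤≤⇒x≈⊤ : ∀ {x} → ⊤ ≤ x → x ≈ ⊤
  ⊤≤⇒x≈⊤ {x} ⊤≤x = ≤-antisym (⊤-maximum x) ⊤≤x

  x≤⊥⇒x≈⊥ : ∀ {x} → x ≤ ⊥ → x ≈ ⊥
  x≤⊥⇒x≈⊥ {x} x≤⊥ = ≤-antisym x≤⊥ (⊥-minimum x)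

  ≉⊥-mono : ∀ {x y} → x ≤ y → x ≉ ⊥ → y ≉ ⊥
  ≉⊥-mono x≤y x≉⊥ y≈⊥ = x≉⊥ (x≤⊥⇒x≈⊥ (≤-trans x≤y (≤-reflexive y≈⊥)))

  ≤⇒∧≈ : ∀ {x y} → x ≤ y → (x ∧ y) ≈ x
  ≤⇒∧≈ {x} {y} x≤y = trans (∧-congˡ (sym x≤y)) (∧-absorbs-∨ x y)

  x∨y≈⊤⇒-x≤y : ∀ {x y} → (x ∨ y) ≈ ⊤ → (- x) ≤ y
  x∨y≈⊤⇒-x≤y {x} {y} x∨y≈⊤ = ≤-trans (≤-reflexive (sym -x∧y≈-x)) (x∧y≤y (- x) y)
    where
    -x∧y≈-x : (- x ∧ y) ≈ - x
    -x∧y≈-x = trans (sym (∨-identityˡ _))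
      (trans (∨-congʳ (sym (∧-complementˡ x)))
      (trans (sym (∧-distribˡ-∨ (- x) x y))
      (trans (∧-congˡ x∨y≈⊤) (∧-identityʳ (- x)))))

  -x≤y⇒x∨y≈⊤ : ∀ {x y} → (- x) ≤ y → (x ∨ y) ≈ ⊤
  -x≤y⇒x∨y≈⊤ {x} -x≤y = ≤-antisym (⊤-maximum _)
    (≤-trans (≤-reflexive (sym (∨-complementʳ x))) (∨-monotonic ≤-refl -x≤y))

  -‿antitone : ∀ {x y} → x ≤ y → (- y) ≤ (- x)
  -‿antitone {x} {y} x≤y = trans (sym (deMorgan₁ y x)) (¬-cong (trans (∧-comm y x) (≤⇒∧≈ x≤y)))

module ModalOperators {c ℓ : Level} (B : BooleanAlgebra c ℓ) where
  open BooleanAlgebra B renaming (¬_ to -_)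
  open BA B
  open BooleanOrder B
  open import Algebra.Lattice.Properties.BooleanAlgebra B using (∨-identityʳ; ∧-zeroˡ)

  IsUpperBound : ∀ {p} → (Carrier → Set p) → Carrier → Set (c ⊔ ℓ ⊔ p)
  IsUpperBound P u = ∀ z → P z → z ≤ u

  IsSup-mono : ∀ {p q} {P : Carrier → Set p} {Q : Carrier → Set q} {s t} →
               (∀ z → P z → Q z) → IsSup P s → IsSup Q t → s ≤ t
  IsSup-mono P⊆Q (_ , s-least) (t-upper , _) = s-least _ (λ z Pz → t-upper z (P⊆Q z Pz))

  IsModal⇒mono : ∀ {h} → IsModal h → ∀ {x y} → x ≤ y → h x ≤ h y
  IsModal⇒mono (h-cong , _ , h-additive) {x} {y} x≤y = trans (sym (h-additive x y)) (h-cong x≤y)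

  NegImages-mono : ∀ {f x y} → x ≤ y → ∀ z → NegImages f x z → NegImages f y z
  NegImages-mono x≤y z (w , w≉⊥ , w≤x , z≈-fw) = w , w≉⊥ , ≤-trans w≤x x≤y , z≈-fw

  joinIsDisc⇒upperBound : ∀ {f h} → IsModal h → JoinIsDisc f h →
                          ∀ x → IsUpperBound (NegImages f x) (h x)
  joinIsDisc⇒upperBound hm f∨h≈f¹ x z (y , y≉⊥ , y≤x , z≈-fy) =
    ≤-trans (≤-reflexive z≈-fy)
      (≤-trans (x∨y≈⊤⇒-x≤y (proj₂ (f∨h≈f¹ y) y≉⊥)) (IsModal⇒mono hm y≤x))

  ∧-nonzero⇒≤-upperBound : ∀ {f w a u} → IsModal f → (w ∧ a) ≉ ⊥ →
                           IsUpperBound (NegImages f a) u → (- f w) ≤ u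
  ∧-nonzero⇒≤-upperBound {f} {w} {a} fm w∧a≉⊥ u-upper =
    ≤-trans (-‿antitone (IsModal⇒mono fm (x∧y≤x w a)))
            (u-upper _ (w ∧ a , w∧a≉⊥ , x∧y≤y w a , refl))

  patch : (Carrier → Carrier) → Carrier → Carrier → Carrier → Carrier
  patch g a u z = g (z ∧ - a) ∨ (g (z ∧ a) ∧ u)

  patch-isModal : ∀ {g} → IsModal g → ∀ a u → IsModal (patch g a u)
  patch-isModal {g} (g-cong , g⊥≈⊥ , g-additive) a u = h-cong , h⊥≈⊥ , h-additive
    where
    open import Relation.Binary.Reasoning.Setoid setoid

    h-cong : ∀ {x y} → x ≈ y → patch g a u x ≈ patch g a u y
    h-cong x≈y = ∨-cong (g-cong (∧-congʳ x≈y)) (∧-congʳ (g-cong (∧-congʳ x≈y)))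

    g⊥∧≈⊥ : ∀ b → g (⊥ ∧ b) ≈ ⊥
    g⊥∧≈⊥ b = trans (g-cong (∧-zeroˡ b)) g⊥≈⊥

    h⊥≈⊥ : patch g a u ⊥ ≈ ⊥
    h⊥≈⊥ = begin
      g (⊥ ∧ - a) ∨ (g (⊥ ∧ a) ∧ u) ≈⟨ ∨-cong (g⊥∧≈⊥ (- a)) (∧-congʳ (g⊥∧≈⊥ a)) ⟩
      ⊥ ∨ (⊥ ∧ u)                   ≈⟨ ∨-congˡ (∧-zeroˡ u) ⟩
      ⊥ ∨ ⊥                         ≈⟨ ∨-identityʳ ⊥ ⟩
      ⊥                             ∎

    g-additive-∧ : ∀ x y b → g ((x ∨ y) ∧ b) ≈ g (x ∧ b) ∨ g (y ∧ b)
    g-additive-∧ x y b = trans (g-cong (∧-distribʳ-∨ b x y)) (g-additive _ _)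

    h-additive : ∀ x y → patch g a u (x ∨ y) ≈ patch g a u x ∨ patch g a u y
    h-additive x y = begin
      g ((x ∨ y) ∧ - a) ∨ (g ((x ∨ y) ∧ a) ∧ u)
        ≈⟨ ∨-cong (g-additive-∧ x y (- a)) (∧-congʳ (g-additive-∧ x y a)) ⟩
      (g (x ∧ - a) ∨ g (y ∧ - a)) ∨ ((g (x ∧ a) ∨ g (y ∧ a)) ∧ u)
        ≈⟨ ∨-congˡ (∧-distribʳ-∨ u _ _) ⟩
      (g (x ∧ - a) ∨ g (y ∧ - a)) ∨ ((g (x ∧ a) ∧ u) ∨ (g (y ∧ a) ∧ u))
        ≈⟨ interchange _ _ _ _ ⟩
      patch g a u x ∨ patch g a u y
        ∎

  patch-≤ : ∀ {g} → IsModal g → ∀ a u → patch g a u a ≤ u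
  patch-≤ {g} (g-cong , g⊥≈⊥ , _) a u =
    ∨-least (≤-trans (≤-reflexive (trans (g-cong (∧-complementʳ a)) g⊥≈⊥)) (⊥-minimum u))
            (x∧y≤y _ u)

module Classical {c ℓ : Level} (em : ExcludedMiddle (c ⊔ ℓ)) (B : BooleanAlgebra c ℓ) where
  open BooleanAlgebra B renaming (¬_ to -_)
  open BA B
  open BooleanOrder B
  open ModalOperators B
  open import Algebra.Lattice.Properties.BooleanAlgebra B using (∨-identityʳ)

  dec-≈⊥ : ∀ x → Dec (x ≈ ⊥)
  dec-≈⊥ x = map′ lower lift (em {Lift c (x ≈ ⊥)})

  ≉⊥-meets-∨ : ∀ {w a b} → w ≉ ⊥ → w ≤ (a ∨ b) → (w ∧ a) ≉ ⊥ ⊎ (w ∧ b) ≉ ⊥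
  ≉⊥-meets-∨ {w} {a} {b} w≉⊥ w≤a∨b with dec-≈⊥ (w ∧ a)
  ... | no w∧a≉⊥ = inj₁ w∧a≉⊥
  ... | yes w∧a≈⊥ = inj₂ λ w∧b≈⊥ → w≉⊥ (begin
    w                   ≈⟨ ≤⇒∧≈ w≤a∨b ⟨
    w ∧ (a ∨ b)         ≈⟨ ∧-distribˡ-∨ w a b ⟩
    (w ∧ a) ∨ (w ∧ b)   ≈⟨ ∨-cong w∧a≈⊥ w∧b≈⊥ ⟩
    ⊥ ∨ ⊥               ≈⟨ ∨-identityʳ ⊥ ⟩
    ⊥                   ∎)
    where open import Relation.Binary.Reasoning.Setoid setoid

  patch-joinIsDisc : ∀ {f g a u} → IsModal f → IsModal g → JoinIsDisc f g →
                     IsUpperBound (NegImages f a) u → JoinIsDisc f (patch g a u)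
  patch-joinIsDisc {f} {g} {a} {u} fm@(f-cong , f⊥≈⊥ , _) gm f∨g≈f¹ u-upper z =
    f∨h≈⊥ , λ z≉⊥ → ⊤≤⇒x≈⊤ (⊤≤f∨h z≉⊥ (≉⊥-meets-∨ z≉⊥ z≤a∨-a))
    where
    open import Relation.Binary.Reasoning.PartialOrder poset
    hm = patch-isModal gm a u

    f∨h≈⊥ : z ≈ ⊥ → (f z ∨ patch g a u z) ≈ ⊥
    f∨h≈⊥ z≈⊥ = trans (∨-cong (trans (f-cong z≈⊥) f⊥≈⊥)
                              (trans (proj₁ hm z≈⊥) (proj₁ (proj₂ hm))))
                      (∨-identityʳ ⊥)

    z≤a∨-a : z ≤ (a ∨ - a)
    z≤a∨-a = ≤-trans (⊤-maximum z) (≤-reflexive (sym (∨-complementʳ a)))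

    ⊤≤f∨g : ∀ {w} → w ≉ ⊥ → w ≤ z → ⊤ ≤ (f z ∨ g w)
    ⊤≤f∨g {w} w≉⊥ w≤z = begin
      ⊤          ≈⟨ proj₂ (f∨g≈f¹ w) w≉⊥ ⟨
      f w ∨ g w  ≤⟨ ∨-monotonic (IsModal⇒mono fm w≤z) ≤-refl ⟩
      f z ∨ g w  ∎

    ⊤≤f∨h : z ≉ ⊥ → (z ∧ a) ≉ ⊥ ⊎ (z ∧ - a) ≉ ⊥ → ⊤ ≤ (f z ∨ patch g a u z)
    ⊤≤f∨h z≉⊥ (inj₁ z∧a≉⊥) = begin
      ⊤                                 ≤⟨ ∧-greatest (⊤≤f∨g z∧a≉⊥ (x∧y≤x z a)) ⊤≤f∨u ⟩
      (f z ∨ g (z ∧ a)) ∧ (f z ∨ u)     ≈⟨ ∨-distribˡ-∧ (f z) _ u ⟨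
      f z ∨ (g (z ∧ a) ∧ u)             ≤⟨ ∨-monotonic ≤-refl (y≤x∨y _ _) ⟩
      f z ∨ patch g a u z               ∎
      where
      ⊤≤f∨u : ⊤ ≤ (f z ∨ u)
      ⊤≤f∨u = ≤-reflexive (sym (-x≤y⇒x∨y≈⊤ (∧-nonzero⇒≤-upperBound fm z∧a≉⊥ u-upper)))
    ⊤≤f∨h z≉⊥ (inj₂ z∧-a≉⊥) = begin
      ⊤                       ≤⟨ ⊤≤f∨g z∧-a≉⊥ (x∧y≤x z (- a)) ⟩
      f z ∨ g (z ∧ - a)       ≤⟨ ∨-monotonic ≤-refl (x≤x∨y _ _) ⟩
      f z ∨ patch g a u z     ∎

  dualPseudocomplement⇒isSup : ∀ {f g} → IsModal f → IsDualPseudocomplement f g →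
                               ∀ x → IsSup (NegImages f x) (g x)
  dualPseudocomplement⇒isSup {g = g} fm (gm , f∨g≈f¹ , g-least) x =
    joinIsDisc⇒upperBound gm f∨g≈f¹ x ,
    λ u u-upper → ≤-trans (g-least (patch g x u) (patch-isModal gm x u)
                                   (patch-joinIsDisc fm gm f∨g≈f¹ u-upper) x)
                          (patch-≤ gm x u)

  module SupremumOperator {f : Carrier → Carrier} (fm : IsModal f)
           (sups : ∀ x → x ≉ ⊥ → Σ Carrier (IsSup (NegImages f x))) where

    sup : Carrier → Carrier
    sup x with dec-≈⊥ x
    ... | yes _ = ⊥
    ... | no x≉⊥ = proj₁ (sups x x≉⊥)

    sup-⊥ : ∀ {x} → x ≈ ⊥ → sup x ≈ ⊥
    sup-⊥ {x} x≈⊥ with dec-≈⊥ x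
    ... | yes _ = refl
    ... | no x≉⊥ = ⊥-elim (x≉⊥ x≈⊥)

    sup-isSup : ∀ {x} → x ≉ ⊥ → IsSup (NegImages f x) (sup x)
    sup-isSup {x} x≉⊥ with dec-≈⊥ x
    ... | yes x≈⊥ = ⊥-elim (x≉⊥ x≈⊥)
    ... | no x≉⊥′ = proj₂ (sups x x≉⊥′)

    sup-mono : ∀ {x y} → x ≤ y → sup x ≤ sup y
    sup-mono {x} x≤y with dec-≈⊥ x
    ... | yes _ = ⊥-minimum _
    ... | no x≉⊥ =
      IsSup-mono (NegImages-mono x≤y) (proj₂ (sups x x≉⊥)) (sup-isSup (≉⊥-mono x≤y x≉⊥))

    sup-subadditive : ∀ x y → sup (x ∨ y) ≤ (sup x ∨ sup y)
    sup-subadditive x y with dec-≈⊥ (x ∨ y)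
    ... | yes _ = ⊥-minimum _
    ... | no x∨y≉⊥ = proj₂ (proj₂ (sups (x ∨ y) x∨y≉⊥)) _ bound
      where
      ≤-sup : ∀ {w a} → (w ∧ a) ≉ ⊥ → (- f w) ≤ sup a
      ≤-sup {w} {a} w∧a≉⊥ =
        ∧-nonzero⇒≤-upperBound fm w∧a≉⊥ (proj₁ (sup-isSup (≉⊥-mono (x∧y≤y w a) w∧a≉⊥)))

      bound : IsUpperBound (NegImages f (x ∨ y)) (sup x ∨ sup y)
      bound z (w , w≉⊥ , w≤x∨y , z≈-fw) with ≉⊥-meets-∨ w≉⊥ w≤x∨y
      ... | inj₁ w∧x≉⊥ = ≤-trans (≤-reflexive z≈-fw) (≤-trans (≤-sup w∧x≉⊥) (x≤x∨y _ _))
      ... | inj₂ w∧y≉⊥ = ≤-trans (≤-reflexive z≈-fw) (≤-trans (≤-sup w∧y≉⊥) (y≤x∨y _ _))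

    sup-isModal : IsModal sup
    sup-isModal =
      (λ x≈y → ≤-antisym (sup-mono (≤-reflexive x≈y)) (sup-mono (≤-reflexive (sym x≈y)))) ,
      sup-⊥ refl ,
      λ x y → ≤-antisym (sup-subadditive x y)
                        (∨-least (sup-mono (x≤x∨y x y)) (sup-mono (y≤x∨y x y)))

    sup-joinIsDisc : JoinIsDisc f sup
    sup-joinIsDisc x =
      (λ x≈⊥ → let f-cong , f⊥≈⊥ , _ = fm in
                 trans (∨-cong (trans (f-cong x≈⊥) f⊥≈⊥) (sup-⊥ x≈⊥)) (∨-identityʳ ⊥)) ,
      λ x≉⊥ → -x≤y⇒x∨y≈⊤ (proj₁ (sup-isSup x≉⊥) _ (x , x≉⊥ , ≤-refl , refl))

    sup-least : ∀ h → IsModal h → JoinIsDisc f h → sup ≤M h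
    sup-least h hm f∨h≈f¹ x with dec-≈⊥ x
    ... | yes _ = ⊥-minimum _
    ... | no x≉⊥ = proj₂ (proj₂ (sups x x≉⊥)) _ (joinIsDisc⇒upperBound hm f∨h≈f¹ x)


    sup-isDualPseudocomplement : IsDualPseudocomplement f sup
    sup-isDualPseudocomplement = sup-isModal , sup-joinIsDisc , sup-least

mainTheorem3 : {c ℓ : Level} → ExcludedMiddle (c ⊔ ℓ) → (B : BooleanAlgebra c ℓ) →
    let open BooleanAlgebra B hiding (¬_) in let open BA B in
    Nontrivial → (f : Carrier → Carrier) → IsModal f →
    ((g : Carrier → Carrier) → IsDualPseudocomplement f g →
        (x : Carrier) → ¬ (x ≈ ⊥) → IsSup (NegImages f x) (g x))
    × (((x : Carrier) → ¬ (x ≈ ⊥) → Σ Carrier (IsSup (NegImages f x))) →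
        Σ (Carrier → Carrier) λ g → IsDualPseudocomplement f g
          × (g ⊥ ≈ ⊥)
          × ((x : Carrier) → ¬ (x ≈ ⊥) → IsSup (NegImages f x) (g x)))
mainTheorem3 em B _ f fm =
  (λ g g-dpc x _ → dualPseudocomplement⇒isSup fm g-dpc x) ,
  λ sups → let open SupremumOperator fm sups in
    sup , sup-isDualPseudocomplement , sup-⊥ refl , λ x → sup-isSup
  where
  open BooleanAlgebra B using (refl)
  open Classical em B
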